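{- Let $\mathcal{C}$ be a class of finite graphs and let $\mathcal{C}\!\downarrow$ denote its hereditary closure, i.e. the class of all graphs that are induced subgraphs of some graph in $\mathcal{C}$. If the $\mathrm{MSO}$ theory of $\mathcal{C}$ is decidable, then the $\mathrm{MSO}$ theory of $\mathcal{C}\!\downarrow$ is decidable.
   Context: Graphs are finite, simple, undirected and loop-free. $\mathrm{MSO}$ is monadic second-order logic over the vocabulary with one binary edge relation $E$ (quantification over vertices and over sets of vertices). The $\mathrm{MSO}$ theory of a graph class $\mathcal{C}$ is the set of all $\mathrm{MSO}$ sentences that are true in every graph of $\mathcal{C}$; it is decidable if there is an algorithm that, given an $\mathrm{MSO}$ sentence, decides whether it belongs to this set. -}

module Defs where

open import Data.Nat using (ℕ)
open import Data.Fin using (Fin)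
open import Data.Bool using (Bool; true; false)
open import Data.Product using (Σ; _×_; ∃)
open import Data.Sum using (_⊎_)
open import Data.Empty using (⊥)
open import Relation.Nullary using (¬_; Dec)
open import Relation.Binary.PropositionalEquality using (_≡_)
open import Function.Definitions using (Injective)

record Graph : Set where
  field
    size  : ℕ
    adj   : Fin size → Fin size → Bool
    sym   : ∀ u v → adj u v ≡ adj v u
    irrefl : ∀ v → adj v v ≡ false

open Graph public

Edge : (G : Graph) → Fin (size G) → Fin (size G) → Set
Edge G u v = adj G u v ≡ true

-- MSO formulas over the vocabulary {E}, de Bruijn style:
-- Formula i j has i free vertex variables and j free set variables.

data Formula : ℕ → ℕ → Set where
  edge  : ∀ {i j} → Fin i → Fin i → Formula i j
  equal : ∀ {i j} → Fin i → Fin i → Formula i j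
  mem   : ∀ {i j} → Fin i → Fin j → Formula i j
  ff    : ∀ {i j} → Formula i j
  neg   : ∀ {i j} → Formula i j → Formula i j
  and   : ∀ {i j} → Formula i j → Formula i j → Formula i j
  or    : ∀ {i j} → Formula i j → Formula i j → Formula i j
  exV   : ∀ {i j} → Formula (ℕ.suc i) j → Formula i j
  allV  : ∀ {i j} → Formula (ℕ.suc i) j → Formula i j
  exS   : ∀ {i j} → Formula i (ℕ.suc j) → Formula i j
  allS  : ∀ {i j} → Formula i (ℕ.suc j) → Formula i j

Sentence : Set
Sentence = Formula 0 0

VSet : Graph → Set
VSet G = Fin (size G) → Bool

extend : ∀ {A : Set} {k} → A → (Fin k → A) → Fin (ℕ.suc k) → A
extend a ρ Fin.zero    = a
extend a ρ (Fin.suc x) = ρ x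

Sat : (G : Graph) {i j : ℕ} → (Fin i → Fin (size G)) → (Fin j → VSet G) → Formula i j → Set
Sat G ρ σ (edge x y)  = Edge G (ρ x) (ρ y)
Sat G ρ σ (equal x y) = ρ x ≡ ρ y
Sat G ρ σ (mem x X)   = σ X (ρ x) ≡ true
Sat G ρ σ ff          = ⊥
Sat G ρ σ (neg φ)     = ¬ Sat G ρ σ φ
Sat G ρ σ (and φ ψ)   = Sat G ρ σ φ × Sat G ρ σ ψ
Sat G ρ σ (or φ ψ)    = Sat G ρ σ φ ⊎ Sat G ρ σ ψ
Sat G ρ σ (exV φ)     = Σ (Fin (size G)) λ v → Sat G (extend v ρ) σ φ
Sat G ρ σ (allV φ)    = (v : Fin (size G)) → Sat G (extend v ρ) σ φ
Sat G ρ σ (exS φ)     = Σ (VSet G) λ X → Sat G ρ (extend X σ) φ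
Sat G ρ σ (allS φ)    = (X : VSet G) → Sat G ρ (extend X σ) φ

noV : ∀ {A : Set} → Fin 0 → A
noV ()

_⊨_ : Graph → Sentence → Set
G ⊨ φ = Sat G noV noV φ

GraphClass : Set₁
GraphClass = Graph → Set

_≤ind_ : Graph → Graph → Set
H ≤ind G = Σ (Fin (size H) → Fin (size G)) λ f →
             Injective _≡_ _≡_ f × (∀ u v → adj H u v ≡ adj G (f u) (f v))

HereditaryClosure : GraphClass → GraphClass
HereditaryClosure C H = Σ Graph λ G → C G × (H ≤ind G)

InMSOTheory : GraphClass → Sentence → Set
InMSOTheory C φ = ∀ G → C G → G ⊨ φ

-- The MSO theory of C is decidable: a (computable, since Agda --safe is
-- constructive) procedure deciding membership of every sentence.
MSODecidable : GraphClass → Set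
MSODecidable C = (φ : Sentence) → Dec (InMSOTheory C φ)

-- For an MSO sentence φ let φ^X be φ with every quantifier
-- to-closureed to a fresh set variable X. If H sits in G as the induced subgraph on
-- the vertex set X, then G satisfies φ^X exactly when H satisfies φ: vertices of
-- H are the vertices of G in X, and sets of vertices of H are the traces on X of
-- sets of vertices of G. Since every induced subgraph of G arises from some X and
-- every X induces a subgraph, the sentence ∀X. φ^X holds throughout C iff φ holds
-- throughout C↓, so a decision procedure for the theory of C answers φ for C↓.
module Submission where

open import Defs
open import Data.Nat using (ℕ)
open import Data.Fin using (Fin; zero; suc; fromℕ; inject₁)
open import Data.Fin.Properties using (any?; _≟_; suc-injective)
open import Data.Bool using (Bool; true; false)
open import Data.Product using (∃; _,_)
open import Data.Product.Function.NonDependent.Propositional using (_×-⇔_)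
open import Data.Sum using (inj₁; inj₂)
open import Data.Sum.Function.Propositional using (_⊎-⇔_)
open import Data.Empty using (⊥-elim)
open import Function using (_∘_)
open import Function.Bundles using (_⇔_; mk⇔; module Equivalence)
open import Function.Construct.Identity using (⇔-id)
open import Function.Definitions using (Injective)
open import Function.Related.TypeIsomorphisms using (¬-cong-⇔)
open import Relation.Nullary using (yes; no)
open import Relation.Nullary.Decidable using (map)
open import Relation.Binary.PropositionalEquality using (_≡_; refl; trans; cong)
import Relation.Binary.PropositionalEquality as ≡

open Equivalence using (to; from)

-- The relativising set variable is the last one, fromℕ j: binding a new set
-- variable shifts it to fromℕ (suc j) = suc (fromℕ j), so it stays the last one.
relativize : ∀ {i j} → Formula i j → Formula i (ℕ.suc j)
relativize (edge x y)        = edge x y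
relativize (equal x y)       = equal x y
relativize (mem x X)         = mem x (inject₁ X)
relativize ff                = ff
relativize (neg φ)           = neg (relativize φ)
relativize (and φ ψ)         = and (relativize φ) (relativize ψ)
relativize (or φ ψ)          = or (relativize φ) (relativize ψ)
relativize {j = j} (exV φ)   = exV (and (mem zero (fromℕ j)) (relativize φ))
relativize {j = j} (allV φ)  = allV (or (neg (mem zero (fromℕ j))) (relativize φ))
relativize (exS φ)           = exS (relativize φ)
relativize (allS φ)          = allS (relativize φ)

record IsImageOf {m n} (X : Fin n → Bool) (f : Fin m → Fin n) : Set where
  field
    onto   : ∀ g → X g ≡ true → ∃ λ h → f h ≡ g
    covers : ∀ h → X (f h) ≡ true

module _ {m n} (f : Fin m → Fin n) where

  pushforward : (Fin m → Bool) → Fin n → Bool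
  pushforward Z g with any? (λ h → f h ≟ g)
  ... | yes (h , _) = Z h
  ... | no _        = false

  pushforward-∘ : Injective _≡_ _≡_ f → ∀ Z h → pushforward Z (f h) ≡ Z h
  pushforward-∘ f-injective Z h with any? (λ h′ → f h′ ≟ f h)
  ... | yes (h′ , fh′≡fh) = cong Z (f-injective fh′≡fh)
  ... | no ∄h′            = ⊥-elim (∄h′ (h , refl))

  pushforward-true⇒∈image : ∀ Z g → pushforward Z g ≡ true → ∃ λ h → f h ≡ g
  pushforward-true⇒∈image Z g Zg with any? (λ h → f h ≟ g)
  ... | yes h,fh≡g = h,fh≡g

  image : Fin n → Bool
  image = pushforward (λ _ → true)

  image-isImage : Injective _≡_ _≡_ f → IsImageOf image f
  image-isImage f-injective = record
    { onto   = pushforward-true⇒∈image (λ _ → true)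
    ; covers = pushforward-∘ f-injective (λ _ → true)
    }

record Enumeration {n} (X : Fin n → Bool) : Set where
  field
    {count}   : ℕ
    element   : Fin count → Fin n
    injective : Injective _≡_ _≡_ element
    isImage   : IsImageOf X element

module _ {n} {X : Fin (ℕ.suc n) → Bool} (E : Enumeration (X ∘ suc)) where
  open Enumeration E
  open IsImageOf isImage

  enumeration-cons : X zero ≡ true → Enumeration X
  enumeration-cons X0 = record
    { element   = element′
    ; injective = injective′
    ; isImage   = record { onto = onto′ ; covers = covers′ }
    }
    where
    element′ : Fin (ℕ.suc count) → Fin (ℕ.suc n)
    element′ = extend zero (suc ∘ element)

    injective′ : Injective _≡_ _≡_ element′
    injective′ {zero}  {zero}  _ = refl
    injective′ {suc a} {suc b} p = cong suc (injective (suc-injective p))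

    onto′ : ∀ g → X g ≡ true → ∃ λ h → element′ h ≡ g
    onto′ zero    _  = zero , refl
    onto′ (suc g) Xg with onto g Xg
    ... | h , refl = suc h , refl

    covers′ : ∀ h → X (element′ h) ≡ true
    covers′ zero    = X0
    covers′ (suc h) = covers h

  enumeration-skip : X zero ≡ false → Enumeration X
  enumeration-skip X0 = record
    { element   = suc ∘ element
    ; injective = injective ∘ suc-injective
    ; isImage   = record { onto = onto′ ; covers = covers }
    }
    where
    onto′ : ∀ g → X g ≡ true → ∃ λ h → suc (element h) ≡ g
    onto′ zero    Xg with () ← trans (≡.sym X0) Xg
    onto′ (suc g) Xg with onto g Xg
    ... | h , refl = h , refl

enumerate : ∀ {n} (X : Fin n → Bool) → Enumeration X
enumerate {ℕ.zero} X = record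
  { count     = 0
  ; element   = λ ()
  ; injective = λ { {()} }
  ; isImage   = record { onto = λ () ; covers = λ () }
  }
enumerate {ℕ.suc n} X with X zero in X0
... | true  = enumeration-cons (enumerate (X ∘ suc)) X0
... | false = enumeration-skip (enumerate (X ∘ suc)) X0

inducedSubgraph : (G : Graph) → VSet G → Graph
inducedSubgraph G X = record
  { size   = count
  ; adj    = λ u v → adj G (element u) (element v)
  ; sym    = λ u v → sym G (element u) (element v)
  ; irrefl = irrefl G ∘ element
  }
  where open Enumeration (enumerate X)

module Relativization {H G : Graph} (f : Fin (size H) → Fin (size G))
                      (f-injective : Injective _≡_ _≡_ f)
                      (f-adj : ∀ u v → adj H u v ≡ adj G (f u) (f v)) where

  record Agree {i j} (ρH : Fin i → Fin (size H)) (σH : Fin j → VSet H)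
                     (ρG : Fin i → Fin (size G)) (σG : Fin (ℕ.suc j) → VSet G) : Set where
    field
      vertices : ∀ x → ρG x ≡ f (ρH x)
      sets     : ∀ X h → σG (inject₁ X) (f h) ≡ σH X h
      domain   : IsImageOf (σG (fromℕ j)) f

  module _ {i j} {ρH : Fin i → Fin (size H)} {σH : Fin j → VSet H}
               {ρG : Fin i → Fin (size G)} {σG : Fin (ℕ.suc j) → VSet G}
               (agree : Agree ρH σH ρG σG) where
    open Agree agree

    Agree-extendV : ∀ h → Agree (extend h ρH) σH (extend (f h) ρG) σG
    Agree-extendV h = record { vertices = vertices′ ; sets = sets ; domain = domain }
      where
      vertices′ : ∀ x → extend (f h) ρG x ≡ f (extend h ρH x)
      vertices′ zero    = refl
      vertices′ (suc x) = vertices x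

    Agree-extendS : ∀ (Y : VSet G) (Z : VSet H) → (∀ h → Y (f h) ≡ Z h) →
                    Agree ρH (extend Z σH) ρG (extend Y σG)
    Agree-extendS Y Z Y∘f≡Z = record { vertices = vertices ; sets = sets′ ; domain = domain }
      where
      sets′ : ∀ X h → extend Y σG (inject₁ X) (f h) ≡ extend Z σH X h
      sets′ zero    = Y∘f≡Z
      sets′ (suc X) = sets X

  Sat-relativize : ∀ {i j} (φ : Formula i j) {ρH σH ρG σG} → Agree ρH σH ρG σG →
                   Sat G ρG σG (relativize φ) ⇔ Sat H ρH σH φ
  Sat-relativize (edge x y) {ρH} agree
    rewrite Agree.vertices agree x | Agree.vertices agree y | f-adj (ρH x) (ρH y) = ⇔-id _
  Sat-relativize (equal x y) agree
    rewrite Agree.vertices agree x | Agree.vertices agree y = mk⇔ f-injective (cong f)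
  Sat-relativize (mem x X) {ρH} agree
    rewrite Agree.vertices agree x | Agree.sets agree X (ρH x) = ⇔-id _
  Sat-relativize ff        agree = ⇔-id _
  Sat-relativize (neg φ)   agree = ¬-cong-⇔ (Sat-relativize φ agree)
  Sat-relativize (and φ ψ) agree = Sat-relativize φ agree ×-⇔ Sat-relativize ψ agree
  Sat-relativize (or φ ψ)  agree = Sat-relativize φ agree ⊎-⇔ Sat-relativize ψ agree
  Sat-relativize (exV φ) {ρH} {σH} {ρG} {σG} agree = mk⇔ to′ from′
    where
    open IsImageOf (Agree.domain agree)
    to′ : Sat G ρG σG (relativize (exV φ)) → Sat H ρH σH (exV φ)
    to′ (g , g∈X , s) with onto g g∈X
    ... | h , refl = h , to (Sat-relativize φ (Agree-extendV agree h)) s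
    from′ : Sat H ρH σH (exV φ) → Sat G ρG σG (relativize (exV φ))
    from′ (h , s) = f h , covers h , from (Sat-relativize φ (Agree-extendV agree h)) s
  Sat-relativize {j = j} (allV φ) {ρH} {σH} {ρG} {σG} agree = mk⇔ to′ from′
    where
    open IsImageOf (Agree.domain agree)
    to′ : Sat G ρG σG (relativize (allV φ)) → Sat H ρH σH (allV φ)
    to′ s h with s (f h)
    ... | inj₁ fh∉X = ⊥-elim (fh∉X (covers h))
    ... | inj₂ t    = to (Sat-relativize φ (Agree-extendV agree h)) t
    from′ : Sat H ρH σH (allV φ) → Sat G ρG σG (relativize (allV φ))
    from′ s g with σG (fromℕ j) g in g∈?X
    ... | false = inj₁ λ ()
    ... | true with onto g g∈?X
    ...   | h , refl = inj₂ (from (Sat-relativize φ (Agree-extendV agree h)) (s h))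
  Sat-relativize (exS φ) {ρH} {σH} {ρG} {σG} agree = mk⇔ to′ from′
    where
    to′ : Sat G ρG σG (relativize (exS φ)) → Sat H ρH σH (exS φ)
    to′ (Y , s) = Y ∘ f , to (Sat-relativize φ (Agree-extendS agree Y (Y ∘ f) λ _ → refl)) s
    from′ : Sat H ρH σH (exS φ) → Sat G ρG σG (relativize (exS φ))
    from′ (Z , s) = pushforward f Z ,
      from (Sat-relativize φ (Agree-extendS agree _ Z (pushforward-∘ f f-injective Z))) s
  Sat-relativize (allS φ) {ρH} {σH} {ρG} {σG} agree = mk⇔ to′ from′
    where
    to′ : Sat G ρG σG (relativize (allS φ)) → Sat H ρH σH (allS φ)
    to′ s Z = to (Sat-relativize φ (Agree-extendS agree _ Z (pushforward-∘ f f-injective Z)))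
                 (s (pushforward f Z))
    from′ : Sat H ρH σH (allS φ) → Sat G ρG σG (relativize (allS φ))
    from′ s Y = from (Sat-relativize φ (Agree-extendS agree Y (Y ∘ f) λ _ → refl)) (s (Y ∘ f))

  ⊨-relativize : ∀ (φ : Sentence) {X : VSet G} → IsImageOf X f →
                 Sat G noV (extend X noV) (relativize φ) ⇔ H ⊨ φ
  ⊨-relativize φ X-isImage = Sat-relativize φ record
    { vertices = λ () ; sets = λ () ; domain = X-isImage }

InMSOTheory-relativize : ∀ (C : GraphClass) (φ : Sentence) →
                         InMSOTheory C (allS (relativize φ)) ⇔ InMSOTheory (HereditaryClosure C) φ
InMSOTheory-relativize C φ = mk⇔ to-closure from-closure
  where
  to-closure : InMSOTheory C (allS (relativize φ)) → InMSOTheory (HereditaryClosure C) φ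
  to-closure C⊨φ^X H (G , G∈C , f , f-injective , f-adj) =
    to (⊨-relativize φ (image-isImage f f-injective)) (C⊨φ^X G G∈C (image f))
    where open Relativization {H} {G} f f-injective f-adj

  from-closure : InMSOTheory (HereditaryClosure C) φ → InMSOTheory C (allS (relativize φ))
  from-closure C↓⊨φ G G∈C X =
    from (⊨-relativize φ isImage)
         (C↓⊨φ (inducedSubgraph G X) (G , G∈C , element , injective , λ _ _ → refl))
    where
    open Enumeration (enumerate X)
    open Relativization {inducedSubgraph G X} {G} element injective (λ _ _ → refl)

proposition1 : (C : GraphClass) → MSODecidable C → MSODecidable (HereditaryClosure C)
proposition1 C decide φ = map (InMSOTheory-relativize C φ) (decide (allS (relativize φ)))
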